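{- Let $b\ge2$ and let $N_1,N_2$ be positive integers relatively prime to $b$ with $N_1\mid N_2$. Let $d$ be a common divisor of $|b|_{N_1}$ and $|b|_{N_2}$. If $d\in\mathcal{M}_b(N_2)$, then $d\in\mathcal{M}_b(N_1)$.
   Context: $|b|_N$ denotes the multiplicative order of $b$ modulo $N$ (defined whenever $\gcd(N,b)=1$), and $\mathbb{U}_N=\{x: 1\le x<N,\ \gcd(x,N)=1\}$. Midy's set: for an integer $d\ge 2$ dividing $|b|_N$, put $L=|b|_N$ and $k=L/d$. For $x\in\mathbb{U}_N$, let $a_1a_2\cdots a_L$ be the base-$b$ digits (padded with leading zeros to exactly $L$ digits) of the integer $x(b^L-1)/N$; this is the period of the base-$b$ expansion of $x/N$. For $j=1,\dots,d$ let $A_j=[a_{(j-1)k+1}\cdots a_{jk}]_b$ be the integer whose base-$b$ digits are the $j$-th block of length $k$, and $S_d(x)=\sum_{j=1}^d A_j$. $N$ has the Midy property for $b$ and $d$ if $b^k-1$ divides $S_d(x)$ for every $x\in\mathbb{U}_N$. The Midy set $\mathcal{M}_b(N)$ is the set of integers $d\ge2$ dividing $|b|_N$ such that $N$ has the Midy property for $b$ and $d$. -}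

module Defs where

open import Data.Nat using (ℕ; zero; suc; _+_; _*_; _∸_; _^_; _≤_; _<_)
open import Data.Nat.DivMod using (_/_; _%_)
open import Data.Nat.Divisibility using (_∣_)
open import Data.Nat.Coprimality using (Coprime)
open import Data.List using (List; map; upTo)
open import Data.Nat.ListAction using (sum)
open import Data.Product using (_×_)
open import Relation.Nullary using (¬_)

-- b^L ≡ 1 (mod N), expressed as N ∣ b^L - 1 (we always have b ≥ 2 so b^L ≥ 1).
PowOne : ℕ → ℕ → ℕ → Set
PowOne b N L = N ∣ (b ^ L ∸ 1)

IsOrder : ℕ → ℕ → ℕ → Set
IsOrder b N L = 1 ≤ L × PowOne b N L × (∀ m → 1 ≤ m → m < L → ¬ PowOne b N m)

-- m / n and m % n with the divisor only required to be a positive number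
-- (divisor 0 gives 0; never used, all divisors here are ≥ 1).
divBy : ℕ → ℕ → ℕ
divBy m zero = 0
divBy m (suc n) = m / suc n

modBy : ℕ → ℕ → ℕ
modBy m zero = 0
modBy m (suc n) = m % suc n

period : ℕ → ℕ → ℕ → ℕ → ℕ
period b N L x = divBy (x * (b ^ L ∸ 1)) N

-- A_j for j = 1..d: the integer formed by the j-th block (from the left) of
-- k base-b digits of P written with exactly L = d k digits (leading zeros).
block : ℕ → ℕ → ℕ → ℕ → ℕ → ℕ
block b k d P j = modBy (divBy P (b ^ ((d ∸ j) * k))) (b ^ k)

Sd : ℕ → ℕ → ℕ → ℕ → ℕ → ℕ
Sd b N L d x = sum (map (λ i → block b (divBy L d) d (period b N L x) (suc i)) (upTo d))

MidyProperty : ℕ → ℕ → ℕ → ℕ → Set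
MidyProperty b N L d =
  ∀ x → 1 ≤ x → x < N → Coprime x N → (b ^ divBy L d ∸ 1) ∣ Sd b N L d x

InMidySet : ℕ → ℕ → ℕ → ℕ → Set
InMidySet b N L d = 2 ≤ d × d ∣ L × MidyProperty b N L d

-- Write L = k d, B = b^k and geom d B = 1 + B + ⋯ + B^(d-1), so that
-- b^L - 1 = (B - 1) · geom d B.  Since B ≡ 1 modulo B - 1, the block sum
-- S_d(x) is congruent modulo B - 1 to the period x (b^L - 1)/N itself.  This
-- gives the Midy criterion: d ∈ M_b(N) iff N ∣ geom d (b^k)
-- (midy-sufficient, midy-necessary).  For N₁ ∣ N₂ the order L₁ divides L₂,
-- say L₂ = t L₁, so b^k₂ = (b^k₁)^t, and the theorem reduces to the
-- arithmetic statement geom-pow-reduce: N ∣ c^d - 1 and N ∣ geom d (c^t)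
-- imply N ∣ geom d c.  That is proved with congruences modulo N: raising to
-- a power prime to d permutes 1, c, …, c^(d-1) (geom-pow-coprime), and a
-- lifting-the-exponent lemma (geom-divisible) handles the factor gcd(t, d).
module Submission where

open import Defs
open import Data.Nat using (ℕ; _≤_)
open import Data.Nat.Divisibility using (_∣_)
open import Data.Nat.Coprimality using (Coprime)

open import Level using (0ℓ)
open import Data.Nat
open import Data.Nat.Properties
open import Data.Nat.Divisibility
open import Data.Nat.DivMod using (_/_; _%_; m/n*n≡m; n/1≡n; m*n/n≡m; m≡m%n+[m/n]*n; m/n/o≡m/[n*o]; /-congʳ; /-monoˡ-≤; m<n⇒m/n≡0; m%n<n)
open import Data.Nat.Coprimality using (1-coprimeTo; coprime-Bézout; coprime-divisor; gcd≡1⇒coprime; coprime-/gcd)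
open import Data.Nat.GCD using (module Bézout; gcd; gcd[m,n]∣m; gcd[m,n]∣n; gcd[m,n]≡0⇒m≡0; gcd[m,n]≡0⇒n≡0; gcd-greatest; c*gcd[m,n]≡gcd[cm,cn])
open import Data.Nat.Induction using (<-rec)
open import Data.Product using (_,_)
open import Data.List using (applyUpTo)
open import Data.List.Properties using (map-upTo)
open import Data.Nat.ListAction using (sum)
open import Relation.Binary.PropositionalEquality
open import Relation.Nullary using (contradiction)
open import Relation.Binary.Bundles using (Setoid)
open import Relation.Binary.Structures using (IsEquivalence)
import Relation.Binary.Reasoning.Setoid as SetoidReasoning
open import Data.Nat.Tactic.RingSolver using (solve-∀)

infix 4 _≡_[mod_]

-- x ≡ y [mod N ]: x and y differ by a multiple of N.  Stated with two
-- multipliers, so that it is a congruence on ℕ without truncated subtraction.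
record _≡_[mod_] (x y N : ℕ) : Set where
  constructor congruent
  field
    multiplierˡ multiplierʳ : ℕ
    equation : x + multiplierˡ * N ≡ y + multiplierʳ * N

module _ {N : ℕ} where

  ≡⇒≡-mod : ∀ {x y} → x ≡ y → x ≡ y [mod N ]
  ≡⇒≡-mod refl = congruent 0 0 refl

  mod-refl : ∀ {x} → x ≡ x [mod N ]
  mod-refl = ≡⇒≡-mod refl

  mod-sym : ∀ {x y} → x ≡ y [mod N ] → y ≡ x [mod N ]
  mod-sym (congruent a b e) = congruent b a (sym e)

  mod-trans : ∀ {x y z} → x ≡ y [mod N ] → y ≡ z [mod N ] → x ≡ z [mod N ]
  mod-trans {x} {y} {z} (congruent a b e₁) (congruent c d e₂) = congruent (a + c) (b + d) (begin
    x + (a + c) * N       ≡⟨ shift x a c N ⟩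
    (x + a * N) + c * N   ≡⟨ cong (_+ c * N) e₁ ⟩
    (y + b * N) + c * N   ≡⟨ swap y b c N ⟩
    (y + c * N) + b * N   ≡⟨ cong (_+ b * N) e₂ ⟩
    (z + d * N) + b * N   ≡⟨ swap z d b N ⟩
    (z + b * N) + d * N   ≡⟨ shift z b d N ⟨
    z + (b + d) * N       ∎)
    where
    open ≡-Reasoning
    shift : ∀ u p q n → u + (p + q) * n ≡ (u + p * n) + q * n
    shift = solve-∀
    swap : ∀ u p q n → (u + p * n) + q * n ≡ (u + q * n) + p * n
    swap = solve-∀

  mod-+ : ∀ {x x′ y y′} → x ≡ x′ [mod N ] → y ≡ y′ [mod N ] → x + y ≡ x′ + y′ [mod N ]
  mod-+ {x} {x′} {y} {y′} (congruent a b e₁) (congruent c d e₂) = congruent (a + c) (b + d) (begin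
    (x + y) + (a + c) * N         ≡⟨ regroup x y a c N ⟩
    (x + a * N) + (y + c * N)     ≡⟨ cong₂ _+_ e₁ e₂ ⟩
    (x′ + b * N) + (y′ + d * N)   ≡⟨ regroup x′ y′ b d N ⟨
    (x′ + y′) + (b + d) * N       ∎)
    where
    open ≡-Reasoning
    regroup : ∀ u v p q n → (u + v) + (p + q) * n ≡ (u + p * n) + (v + q * n)
    regroup = solve-∀

  mod-* : ∀ {x x′ y y′} → x ≡ x′ [mod N ] → y ≡ y′ [mod N ] → x * y ≡ x′ * y′ [mod N ]
  mod-* {x} {x′} {y} {y′} (congruent a b e₁) (congruent c d e₂) =
    congruent (x * c + a * y + a * c * N) (x′ * d + b * y′ + b * d * N) (begin
      x * y + (x * c + a * y + a * c * N) * N    ≡⟨ expand x y a c N ⟨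
      (x + a * N) * (y + c * N)                  ≡⟨ cong₂ _*_ e₁ e₂ ⟩
      (x′ + b * N) * (y′ + d * N)                ≡⟨ expand x′ y′ b d N ⟩
      x′ * y′ + (x′ * d + b * y′ + b * d * N) * N ∎)
    where
    open ≡-Reasoning
    expand : ∀ u v p q n → (u + p * n) * (v + q * n) ≡ u * v + (u * q + p * v + p * q * n) * n
    expand = solve-∀

  mod-^ : ∀ {x y} n → x ≡ y [mod N ] → x ^ n ≡ y ^ n [mod N ]
  mod-^ zero    _   = mod-refl
  mod-^ (suc n) x≡y = mod-* x≡y (mod-^ n x≡y)

  mod-+ˡ : ∀ u {x y} → x ≡ y [mod N ] → u + x ≡ u + y [mod N ]
  mod-+ˡ u = mod-+ (mod-refl {u})

  mod-*ˡ : ∀ u {x y} → x ≡ y [mod N ] → u * x ≡ u * y [mod N ]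
  mod-*ˡ u = mod-* (mod-refl {u})

  mod-*ʳ : ∀ u {x y} → x ≡ y [mod N ] → x * u ≡ y * u [mod N ]
  mod-*ʳ u x≡y = mod-* x≡y (mod-refl {u})

  mod-+-cancelʳ : ∀ {x y} z → x + z ≡ y + z [mod N ] → x ≡ y [mod N ]
  mod-+-cancelʳ {x} {y} z (congruent a b e) = congruent a b
    (+-cancelˡ-≡ z _ _ (trans (move x a) (trans e (sym (move y b)))))
    where
    move : ∀ u p → z + (u + p * N) ≡ (u + z) + p * N
    move u p = trans (sym (+-assoc z u (p * N))) (cong (_+ p * N) (+-comm z u))

  ∣⇒≡0 : ∀ {x} → N ∣ x → x ≡ 0 [mod N ]
  ∣⇒≡0 (divides k refl) = congruent 0 k (+-identityʳ (k * N))

  ≡0⇒∣ : ∀ {x} → x ≡ 0 [mod N ] → N ∣ x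
  ≡0⇒∣ {x} (congruent a b e) =
    ∣m+n∣m⇒∣n (subst (N ∣_) (sym (trans (+-comm (a * N) x) e)) (n∣m*n b)) (n∣m*n a)

  ∣∸1⇒≡1 : ∀ {x} → 1 ≤ x → N ∣ x ∸ 1 → x ≡ 1 [mod N ]
  ∣∸1⇒≡1 {suc x} _ N∣x = mod-+ˡ 1 (∣⇒≡0 N∣x)

  ≡1⇒∣∸1 : ∀ {x} → x ≡ 1 [mod N ] → N ∣ x ∸ 1
  ≡1⇒∣∸1 {zero}  _   = N ∣0
  ≡1⇒∣∸1 {suc x} x≡1 = ≡0⇒∣ (mod-+-cancelʳ 1 (mod-trans (≡⇒≡-mod (+-comm x 1)) x≡1))

mod-∣ : ∀ {N x y} → x ≡ y [mod N ] → N ∣ y → N ∣ x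
mod-∣ x≡y N∣y = ≡0⇒∣ (mod-trans x≡y (∣⇒≡0 N∣y))

mod-isEquivalence : ∀ N → IsEquivalence (λ x y → x ≡ y [mod N ])
mod-isEquivalence N = record { refl = mod-refl ; sym = mod-sym ; trans = mod-trans }

mod-setoid : ℕ → Setoid 0ℓ 0ℓ
mod-setoid N = record { isEquivalence = mod-isEquivalence N }

module ≡-mod-Reasoning (N : ℕ) = SetoidReasoning (mod-setoid N)

geom : ℕ → ℕ → ℕ
geom zero    x = 0
geom (suc n) x = 1 + x * geom n x

geom-+ : ∀ m n x → geom (m + n) x ≡ geom m x + x ^ m * geom n x
geom-+ zero    n x = sym (+-identityʳ (geom n x))
geom-+ (suc m) n x = begin
  1 + x * geom (m + n) x                     ≡⟨ cong (λ g → 1 + x * g) (geom-+ m n x) ⟩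
  1 + x * (geom m x + x ^ m * geom n x)      ≡⟨ distrib (geom m x) x (x ^ m) (geom n x) ⟩
  (1 + x * geom m x) + x * x ^ m * geom n x  ∎
  where
  open ≡-Reasoning
  distrib : ∀ g x p h → 1 + x * (g + p * h) ≡ (1 + x * g) + x * p * h
  distrib = solve-∀

-- A sum of m n terms splits into n blocks of m terms.
geom-* : ∀ m n x → geom (m * n) x ≡ geom m x * geom n (x ^ m)
geom-* m zero    x = trans (cong (λ e → geom e x) (*-zeroʳ m)) (sym (*-zeroʳ (geom m x)))
geom-* m (suc n) x = begin
  geom (m * suc n) x                             ≡⟨ cong (λ e → geom e x) (*-suc m n) ⟩
  geom (m + m * n) x                             ≡⟨ geom-+ m (m * n) x ⟩
  geom m x + x ^ m * geom (m * n) x              ≡⟨ cong (λ g → geom m x + x ^ m * g) (geom-* m n x) ⟩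
  geom m x + x ^ m * (geom m x * geom n (x ^ m)) ≡⟨ factor (geom m x) (x ^ m) (geom n (x ^ m)) ⟩
  geom m x * (1 + x ^ m * geom n (x ^ m))        ∎
  where
  open ≡-Reasoning
  factor : ∀ g p h → g + p * (g * h) ≡ g * (1 + p * h)
  factor = solve-∀

geom-shift : ∀ n x → x * geom n x + 1 ≡ geom n x + x ^ n
geom-shift zero    x = cong (_+ 1) (*-zeroʳ x)
geom-shift (suc n) x = begin
  x * (1 + x * g) + 1      ≡⟨ rotate x g ⟩
  1 + x * (x * g + 1)      ≡⟨ cong (λ e → 1 + x * e) (geom-shift n x) ⟩
  1 + x * (g + x ^ n)      ≡⟨ distrib x g (x ^ n) ⟩
  (1 + x * g) + x * x ^ n  ∎
  where
  open ≡-Reasoning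
  g = geom n x
  rotate : ∀ x g → x * (1 + x * g) + 1 ≡ 1 + x * (x * g + 1)
  rotate = solve-∀
  distrib : ∀ x g p → 1 + x * (g + p) ≡ (1 + x * g) + x * p
  distrib = solve-∀

geom-telescope : ∀ n x → (x ∸ 1) * geom n x ≡ x ^ n ∸ 1
geom-telescope n zero    = sym (0^n∸1≡0 n)
  where
  0^n∸1≡0 : ∀ n → 0 ^ n ∸ 1 ≡ 0
  0^n∸1≡0 zero    = refl
  0^n∸1≡0 (suc n) = refl
geom-telescope n (suc x) =
  sym (trans (cong (_∸ 1) (sym x*g+1≡xⁿ)) (m+n∸n≡m (x * g) 1))
  where
  g = geom n (suc x)
  x*g+1≡xⁿ : x * g + 1 ≡ suc x ^ n
  x*g+1≡xⁿ = +-cancelˡ-≡ g _ _ (trans (sym (+-assoc g (x * g) 1)) (geom-shift n (suc x)))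

module _ {N : ℕ} where
  open ≡-mod-Reasoning N

  geom-cong : ∀ {x y} n → x ≡ y [mod N ] → geom n x ≡ geom n y [mod N ]
  geom-cong zero    _   = mod-refl
  geom-cong (suc n) x≡y = mod-+ mod-refl (mod-* x≡y (geom-cong n x≡y))

  geom-at-1 : ∀ {x} n → x ≡ 1 [mod N ] → geom n x ≡ n [mod N ]
  geom-at-1 {x} n x≡1 = mod-trans (geom-cong n x≡1) (≡⇒≡-mod (geom-one n))
    where
    geom-one : ∀ n → geom n 1 ≡ n
    geom-one zero    = refl
    geom-one (suc n) = cong suc (trans (*-identityˡ (geom n 1)) (geom-one n))

  -- If x^n ≡ 1 then multiplying by x permutes the n terms of geom n x.
  geom-fixed : ∀ x n → x ^ n ≡ 1 [mod N ] → x * geom n x ≡ geom n x [mod N ]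
  geom-fixed x n xⁿ≡1 = mod-+-cancelʳ 1 (begin
    x * geom n x + 1   ≡⟨ geom-shift n x ⟩
    geom n x + x ^ n   ≈⟨ mod-+ˡ (geom n x) xⁿ≡1 ⟩
    geom n x + 1       ∎)

  pow-fixed : ∀ x {z} m → x * z ≡ z [mod N ] → x ^ m * z ≡ z [mod N ]
  pow-fixed x {z} zero    _     = ≡⇒≡-mod (+-identityʳ z)
  pow-fixed x {z} (suc m) xz≡z = begin
    x * x ^ m * z     ≡⟨ *-assoc x (x ^ m) z ⟩
    x * (x ^ m * z)   ≈⟨ mod-*ˡ x (pow-fixed x m xz≡z) ⟩
    x * z             ≈⟨ xz≡z ⟩
    z                 ∎

  geom-on-fixed : ∀ w {z} n → w * z ≡ z [mod N ] → geom n w * z ≡ n * z [mod N ]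
  geom-on-fixed w     zero    _     = mod-refl
  geom-on-fixed w {z} (suc n) wz≡z = begin
    (1 + w * geom n w) * z   ≡⟨ distrib w (geom n w) z ⟩
    z + w * (geom n w * z)   ≈⟨ mod-+ˡ z (mod-*ˡ w (geom-on-fixed w n wz≡z)) ⟩
    z + w * (n * z)          ≡⟨ cong (z +_) (swap w n z) ⟩
    z + n * (w * z)          ≈⟨ mod-+ˡ z (mod-*ˡ n wz≡z) ⟩
    z + n * z                ∎
    where
    distrib : ∀ w g z → (1 + w * g) * z ≡ z + w * (g * z)
    distrib = solve-∀
    swap : ∀ w n z → w * (n * z) ≡ n * (w * z)
    swap = solve-∀

  bezout-fixed : ∀ x {z} m n α β → 1 + β * n ≡ α * m →
    x ^ m * z ≡ z [mod N ] → x ^ n * z ≡ z [mod N ] → x * z ≡ z [mod N ]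
  bezout-fixed x {z} m n α β eq xᵐ-fixes xⁿ-fixes = begin
    x * z                    ≈⟨ mod-*ˡ x (pow-fixed (x ^ n) β xⁿ-fixes) ⟨
    x * ((x ^ n) ^ β * z)    ≡⟨ *-assoc x ((x ^ n) ^ β) z ⟨
    x * (x ^ n) ^ β * z      ≡⟨ cong (λ e → x * e * z) (^-*-assoc x n β) ⟩
    x ^ suc (n * β) * z      ≡⟨ cong (λ e → x ^ e * z) exponents ⟩
    x ^ (m * α) * z          ≡⟨ cong (_* z) (^-*-assoc x m α) ⟨
    (x ^ m) ^ α * z          ≈⟨ pow-fixed (x ^ m) α xᵐ-fixes ⟩
    z                        ∎
    where
    exponents : suc (n * β) ≡ m * α
    exponents = trans (cong suc (*-comm n β)) (trans eq (*-comm α m))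

  -- If x^m and x^n fix z for coprime m, n, then x fixes z
  -- (by Bézout, x = x^(α m) · x^(-β n)).
  coprime-fixed : ∀ x {z} m n → Coprime m n →
    x ^ m * z ≡ z [mod N ] → x ^ n * z ≡ z [mod N ] → x * z ≡ z [mod N ]
  coprime-fixed x m n cop xᵐ-fixes xⁿ-fixes with coprime-Bézout cop
  ... | Bézout.+- α β eq = bezout-fixed x m n α β eq xᵐ-fixes xⁿ-fixes
  ... | Bézout.-+ α β eq = bezout-fixed x n m β α eq xⁿ-fixes xᵐ-fixes

  -- Cancellation of factors m and n with gcd 1, via 1 + β n = α m:
  -- z + β n z = α m z ≡ α m w = w + β n w ≡ w + β n z.
  bezout-cancel : ∀ {z w} m n α β → 1 + β * n ≡ α * m →
    m * z ≡ m * w [mod N ] → n * z ≡ n * w [mod N ] → z ≡ w [mod N ]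
  bezout-cancel {z} {w} m n α β eq mz≡mw nz≡nw = mod-+-cancelʳ (β * (n * z)) (begin
    z + β * (n * z)   ≡⟨ scaled z ⟩
    α * (m * z)       ≈⟨ mod-*ˡ α mz≡mw ⟩
    α * (m * w)       ≡⟨ scaled w ⟨
    w + β * (n * w)   ≈⟨ mod-+ˡ w (mod-*ˡ β nz≡nw) ⟨
    w + β * (n * z)   ∎)
    where
    scaled : ∀ u → u + β * (n * u) ≡ α * (m * u)
    scaled u = trans (distrib u β n) (trans (cong (_* u) eq) (*-assoc α m u))
      where
      distrib : ∀ u β n → u + β * (n * u) ≡ (1 + β * n) * u
      distrib = solve-∀

  coprime-cancel : ∀ {z w} m n → Coprime m n →
    m * z ≡ m * w [mod N ] → n * z ≡ n * w [mod N ] → z ≡ w [mod N ]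
  coprime-cancel m n cop mz≡mw nz≡nw with coprime-Bézout cop
  ... | Bézout.+- α β eq = bezout-cancel m n α β eq mz≡mw nz≡nw
  ... | Bézout.-+ α β eq = bezout-cancel n m β α eq nz≡nw mz≡mw

  pow-root : ∀ c t d → c ^ d ≡ 1 [mod N ] → (c ^ t) ^ d ≡ 1 [mod N ]
  pow-root c t d cᵈ≡1 = begin
    (c ^ t) ^ d   ≡⟨ ^-*-assoc c t d ⟩
    c ^ (t * d)   ≡⟨ cong (c ^_) (*-comm t d) ⟩
    c ^ (d * t)   ≡⟨ ^-*-assoc c d t ⟨
    (c ^ d) ^ t   ≈⟨ mod-^ t cᵈ≡1 ⟩
    1 ^ t         ≡⟨ ^-zeroˡ t ⟩
    1             ∎

  -- If c^d ≡ 1 and t is prime to d, then raising to the t-th power permutes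
  -- 1, c, …, c^(d-1) modulo N, so geom d (c^t) ≡ geom d c.  We show that
  -- both sums become equal after multiplication by d and by t.
  geom-pow-coprime : ∀ c t d → Coprime t d → c ^ d ≡ 1 [mod N ] →
    geom d (c ^ t) ≡ geom d c [mod N ]
  geom-pow-coprime c t d cop cᵈ≡1 = coprime-cancel t d cop t-multiples d-multiples
    where
    y = c ^ t
    a = geom d y
    g = geom d c
    yᵈ≡1 : y ^ d ≡ 1 [mod N ]
    yᵈ≡1 = pow-root c t d cᵈ≡1
    c-fixes-g : c * g ≡ g [mod N ]
    c-fixes-g = geom-fixed c d cᵈ≡1
    y-fixes-g : y * g ≡ g [mod N ]
    y-fixes-g = pow-fixed c t c-fixes-g
    y-fixes-a : y * a ≡ a [mod N ]
    y-fixes-a = geom-fixed y d yᵈ≡1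
    cᵈ-fixes-a : c ^ d * a ≡ a [mod N ]
    cᵈ-fixes-a = mod-trans (mod-*ʳ a cᵈ≡1) (≡⇒≡-mod (*-identityˡ a))
    c-fixes-a : c * a ≡ a [mod N ]
    c-fixes-a = coprime-fixed c t d cop y-fixes-a cᵈ-fixes-a
    d-multiples : d * a ≡ d * g [mod N ]
    d-multiples = begin
      d * a   ≈⟨ geom-on-fixed c d c-fixes-a ⟨
      g * a   ≡⟨ *-comm g a ⟩
      a * g   ≈⟨ geom-on-fixed y d y-fixes-g ⟩
      d * g   ∎
    t-multiples : t * a ≡ t * g [mod N ]
    t-multiples = begin
      t * a                ≈⟨ geom-on-fixed c t c-fixes-a ⟨
      geom t c * a         ≡⟨ geom-* t d c ⟨
      geom (t * d) c       ≡⟨ cong (λ e → geom e c) (*-comm t d) ⟩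
      geom (d * t) c       ≡⟨ geom-* d t c ⟩
      g * geom t (c ^ d)   ≈⟨ mod-*ˡ g (geom-at-1 t cᵈ≡1) ⟩
      g * t                ≡⟨ *-comm g t ⟩
      t * g                ∎

pow-of-multiple : ∀ c m g → c ^ (m * g) ≡ (c ^ g) ^ m
pow-of-multiple c m g = trans (cong (c ^_) (*-comm m g)) (sym (^-*-assoc c g m))

-- Let s = gcd(h, c - 1).  If s = 1 the claim follows
-- from (c - 1) · geom g c = c^g - 1.  Otherwise s ∣ geom s c (its s terms are
-- ≡ 1 mod s), the claim for h/s < h and c^s gives h/s ∣ geom (g/s) (c^s), and
-- geom g c = geom s c · geom (g/s) (c^s).
DividesGeom : ℕ → Set
DividesGeom h = ∀ c g → 1 ≤ c → h ∣ g → h ∣ c ^ g ∸ 1 → h ∣ geom g c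

geom-divisible : ∀ h → DividesGeom h
geom-divisible = <-rec DividesGeom step
  where
  step : ∀ h → (∀ {h′} → h′ < h → DividesGeom h′) → DividesGeom h
  step zero _ c g _ h∣g _ rewrite 0∣⇒≡0 h∣g = ∣-refl
  step h@(suc _) rec c g 1≤c h∣g h∣cᵍ-1 with gcd h (c ∸ 1) in s≡gcd
  ... | zero = contradiction (gcd[m,n]≡0⇒m≡0 {h} {c ∸ 1} s≡gcd) λ ()
  ... | suc zero = coprime-divisor (gcd≡1⇒coprime {h} {c ∸ 1} s≡gcd)
                     (subst (h ∣_) (sym (geom-telescope g c)) h∣cᵍ-1)
  ... | s@(suc (suc _)) = subst₂ _∣_ (sym h≡s*h′) (sym geom-split)
                            (*-pres-∣ s∣geom h′∣geom)
    where
    s∣h : s ∣ h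
    s∣h = subst (_∣ h) s≡gcd (gcd[m,n]∣m h (c ∸ 1))
    s∣c-1 : s ∣ c ∸ 1
    s∣c-1 = subst (_∣ c ∸ 1) s≡gcd (gcd[m,n]∣n h (c ∸ 1))
    h′ = h / s
    g′ = g / s
    h≡s*h′ : h ≡ s * h′
    h≡s*h′ = trans (sym (m/n*n≡m s∣h)) (*-comm h′ s)
    g≡s*g′ : g ≡ s * g′
    g≡s*g′ = trans (sym (m/n*n≡m (∣-trans s∣h h∣g))) (*-comm g′ s)
    s∣geom : s ∣ geom s c
    s∣geom = mod-∣ (geom-at-1 s (∣∸1⇒≡1 1≤c s∣c-1)) ∣-refl
    h′<h : h′ < h
    h′<h = subst (h′ <_) (trans (*-comm h′ s) (sym h≡s*h′)) (m<m*n h′ s (s≤s (s≤s z≤n)))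
      where
      instance
        h′≢0 : NonZero h′
        h′≢0 = m*n≢0⇒n≢0 s {{subst NonZero h≡s*h′ _}}
    h′∣g′ : h′ ∣ g′
    h′∣g′ = *-cancelˡ-∣ s (subst₂ _∣_ h≡s*h′ g≡s*g′ h∣g)
    h′∣cˢᵍ′-1 : h′ ∣ (c ^ s) ^ g′ ∸ 1
    h′∣cˢᵍ′-1 = ∣-trans (subst (h′ ∣_) (sym h≡s*h′) (n∣m*n s))
      (subst (λ e → h ∣ e ∸ 1) (trans (cong (c ^_) g≡s*g′) (sym (^-*-assoc c s g′))) h∣cᵍ-1)
    h′∣geom : h′ ∣ geom g′ (c ^ s)
    h′∣geom = rec h′<h (c ^ s) g′ (m^n>0 c {{>-nonZero 1≤c}} s) h′∣g′ h′∣cˢᵍ′-1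
    geom-split : geom g c ≡ geom s c * geom g′ (c ^ s)
    geom-split = trans (cong (λ e → geom e c) g≡s*g′) (geom-* s g′ c)

-- Put g = gcd(t, d), t = t′g, d = d′g, c₁ = c^g and
-- a = geom d′ c₁.  Modulo N, c₁^d′ ≡ 1, so (geom-pow-coprime)
--   geom d (c^t) = geom d′ (c₁^t′) · geom g (c^(t d′)) ≡ a · g,
-- whence N ∣ a g; also N ∣ a (c₁ - 1) = c^d - 1.  So N divides
-- a · gcd(g, c^g - 1), which divides a · geom g c = geom d c (geom-divisible).
geom-pow-reduce : ∀ N c d t → 1 ≤ c → 1 ≤ d →
  N ∣ c ^ d ∸ 1 → N ∣ geom d (c ^ t) → N ∣ geom d c
geom-pow-reduce N c d t 1≤c 1≤d N∣cᵈ-1 N∣geom-cᵗ =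
  subst (N ∣_) (sym geom-d-c) (∣-trans N∣a*gcd (*-monoʳ-∣ a gcd∣geom))
  where
  open ≡-mod-Reasoning N
  g = gcd t d
  instance
    g≢0 : NonZero g
    g≢0 = ≢-nonZero λ g≡0 → contradiction (gcd[m,n]≡0⇒n≡0 t {d} g≡0) (≢-nonZero⁻¹ d {{>-nonZero 1≤d}})
  t′ = t / g
  d′ = d / g
  t≡t′g : t ≡ t′ * g
  t≡t′g = sym (m/n*n≡m (gcd[m,n]∣m t d))
  d≡d′g : d ≡ d′ * g
  d≡d′g = sym (m/n*n≡m (gcd[m,n]∣n t d))
  c₁ = c ^ g
  a = geom d′ c₁
  cᵈ≡c₁ᵈ′ : c ^ d ≡ c₁ ^ d′
  cᵈ≡c₁ᵈ′ = trans (cong (c ^_) d≡d′g) (pow-of-multiple c d′ g)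
  cᵗ≡c₁ᵗ′ : c ^ t ≡ c₁ ^ t′
  cᵗ≡c₁ᵗ′ = trans (cong (c ^_) t≡t′g) (pow-of-multiple c t′ g)
  c₁ᵈ′≡1 : c₁ ^ d′ ≡ 1 [mod N ]
  c₁ᵈ′≡1 = subst (λ e → e ≡ 1 [mod N ]) cᵈ≡c₁ᵈ′ (∣∸1⇒≡1 (m^n>0 c {{>-nonZero 1≤c}} d) N∣cᵈ-1)
  geom-cᵗ≡a*g : geom d (c ^ t) ≡ a * g [mod N ]
  geom-cᵗ≡a*g = begin
    geom d (c ^ t)                          ≡⟨ cong₂ geom d≡d′g cᵗ≡c₁ᵗ′ ⟩
    geom (d′ * g) (c₁ ^ t′)                 ≡⟨ geom-* d′ g (c₁ ^ t′) ⟩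
    geom d′ (c₁ ^ t′) * geom g ((c₁ ^ t′) ^ d′)
                                            ≈⟨ mod-* (geom-pow-coprime c₁ t′ d′ (coprime-/gcd t d) c₁ᵈ′≡1)
                                                     (geom-at-1 g (pow-root c₁ t′ d′ c₁ᵈ′≡1)) ⟩
    a * g                                   ∎
  N∣a*g : N ∣ a * g
  N∣a*g = mod-∣ (mod-sym geom-cᵗ≡a*g) N∣geom-cᵗ
  N∣a*[c₁-1] : N ∣ a * (c₁ ∸ 1)
  N∣a*[c₁-1] = subst (N ∣_) (trans (sym (geom-telescope d′ c₁)) (*-comm (c₁ ∸ 1) a))
                 (subst (λ e → N ∣ e ∸ 1) cᵈ≡c₁ᵈ′ N∣cᵈ-1)
  N∣a*gcd : N ∣ a * gcd g (c₁ ∸ 1)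
  N∣a*gcd = subst (N ∣_) (sym (c*gcd[m,n]≡gcd[cm,cn] a g (c₁ ∸ 1))) (gcd-greatest N∣a*g N∣a*[c₁-1])
  gcd∣geom : gcd g (c₁ ∸ 1) ∣ geom g c
  gcd∣geom = geom-divisible _ c g 1≤c (gcd[m,n]∣m g (c₁ ∸ 1)) (gcd[m,n]∣n g (c₁ ∸ 1))
  geom-d-c : geom d c ≡ a * geom g c
  geom-d-c = trans (cong (λ e → geom e c) (trans d≡d′g (*-comm d′ g)))
               (trans (geom-* g d′ c) (*-comm (geom g c) a))

divBy≡/ : ∀ m n .{{_ : NonZero n}} → divBy m n ≡ m / n
divBy≡/ m (suc n) = refl

-- Casting out (B - 1)s: since B ≡ 1 modulo B - 1, replacing X by its last
-- base-B digit plus the remaining digits does not change X mod B - 1.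
mod+div≡ : ∀ X B → 1 ≤ B → modBy X B + divBy X B ≡ X [mod B ∸ 1 ]
mod+div≡ X B@(suc B-1) _ = begin
  X % B + X / B       ≡⟨ cong (X % B +_) (*-identityʳ (X / B)) ⟨
  X % B + X / B * 1   ≈⟨ mod-+ˡ (X % B) (mod-*ˡ (X / B) B≡1) ⟨
  X % B + X / B * B   ≡⟨ m≡m%n+[m/n]*n X B ⟨
  X                   ∎
  where
  open ≡-mod-Reasoning B-1
  B≡1 : B ≡ 1 [mod B-1 ]
  B≡1 = congruent 0 1 refl

divBy-pow-+ : ∀ b k m P → 1 ≤ b → divBy P (b ^ (k + m)) ≡ divBy (divBy P (b ^ m)) (b ^ k)
divBy-pow-+ b k m P 1≤b = begin
  divBy P (b ^ (k + m))            ≡⟨ divBy≡/ P (b ^ (k + m)) ⟩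
  P / b ^ (k + m)                  ≡⟨ /-congʳ (trans (^-distribˡ-+-* b k m) (*-comm (b ^ k) (b ^ m))) ⟩
  P / (b ^ m * b ^ k)              ≡⟨ m/n/o≡m/[n*o] P (b ^ m) (b ^ k) ⟨
  P / b ^ m / b ^ k                ≡⟨ cong (_/ b ^ k) (divBy≡/ P (b ^ m)) ⟨
  divBy P (b ^ m) / b ^ k          ≡⟨ divBy≡/ (divBy P (b ^ m)) (b ^ k) ⟨
  divBy (divBy P (b ^ m)) (b ^ k)  ∎
  where
  open ≡-Reasoning
  instance
    b≢0 : NonZero b
    b≢0 = >-nonZero 1≤b
    bᵏ≢0 : NonZero (b ^ k)
    bᵏ≢0 = m^n≢0 b k
    bᵐ≢0 : NonZero (b ^ m)
    bᵐ≢0 = m^n≢0 b m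
    bᵏ⁺ᵐ≢0 : NonZero (b ^ (k + m))
    bᵏ⁺ᵐ≢0 = m^n≢0 b (k + m)
    bᵐ*bᵏ≢0 : NonZero (b ^ m * b ^ k)
    bᵐ*bᵏ≢0 = m*n≢0 (b ^ m) (b ^ k)

blockSum : ℕ → ℕ → ℕ → ℕ → ℕ
blockSum b k d P = sum (applyUpTo (λ i → block b k d P (suc i)) d)

-- The d lowest k-digit blocks of P plus the part of P above them is ≡ P modulo
-- b^k - 1.  Induction on d: the new top block is X % b^k for X = P / b^(d k).
blocks+rest≡ : ∀ b k d P → 1 ≤ b →
  blockSum b k d P + divBy P (b ^ (d * k)) ≡ P [mod b ^ k ∸ 1 ]
blocks+rest≡ b k zero    P _   = ≡⇒≡-mod (n/1≡n P)
blocks+rest≡ b k (suc d) P 1≤b = begin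
  (modBy X B + S) + divBy P (b ^ (k + d * k))   ≡⟨ cong (modBy X B + S +_) (divBy-pow-+ b k (d * k) P 1≤b) ⟩
  (modBy X B + S) + divBy X B                   ≡⟨ swap (modBy X B) S (divBy X B) ⟩
  S + (modBy X B + divBy X B)                   ≈⟨ mod-+ˡ S (mod+div≡ X B (m^n>0 b {{>-nonZero 1≤b}} k)) ⟩
  S + X                                         ≈⟨ blocks+rest≡ b k d P 1≤b ⟩
  P                                             ∎
  where
  open ≡-mod-Reasoning (b ^ k ∸ 1)
  B = b ^ k
  X = divBy P (b ^ (d * k))
  S = blockSum b k d P
  swap : ∀ u v w → (u + v) + w ≡ v + (u + w)
  swap = solve-∀

blockSum≡ : ∀ b k d P → 1 ≤ b → P < b ^ (d * k) → blockSum b k d P ≡ P [mod b ^ k ∸ 1 ]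
blockSum≡ b k d P 1≤b P<bᵈᵏ = mod-trans (≡⇒≡-mod (sym no-rest)) (blocks+rest≡ b k d P 1≤b)
  where
  instance
    bᵈᵏ≢0 : NonZero (b ^ (d * k))
    bᵈᵏ≢0 = m^n≢0 b (d * k) {{>-nonZero 1≤b}}
  no-rest : blockSum b k d P + divBy P (b ^ (d * k)) ≡ blockSum b k d P
  no-rest = trans (cong (blockSum b k d P +_) (trans (divBy≡/ P _) (m<n⇒m/n≡0 P<bᵈᵏ)))
                  (+-identityʳ _)

divBy-* : ∀ k d → 1 ≤ d → divBy (k * d) d ≡ k
divBy-* k d@(suc _) _ = m*n/n≡m k d

factor-pos : ∀ {L} k d → 1 ≤ L → L ≡ k * d → 1 ≤ k
factor-pos zero    d 1≤L refl = contradiction 1≤L λ ()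
factor-pos (suc k) d _   _    = s≤s z≤n

pow∸1-factor : ∀ b k d → b ^ (k * d) ∸ 1 ≡ (b ^ k ∸ 1) * geom d (b ^ k)
pow∸1-factor b k d = trans (cong (_∸ 1) (sym (^-*-assoc b k d))) (sym (geom-telescope d (b ^ k)))

period-exact : ∀ b N L x r → 1 ≤ N → b ^ L ∸ 1 ≡ r * N → period b N L x ≡ x * r
period-exact b N@(suc _) L x r _ bᴸ-1≡rN = begin
  divBy (x * (b ^ L ∸ 1)) N   ≡⟨ cong (λ e → divBy (x * e) N) bᴸ-1≡rN ⟩
  divBy (x * (r * N)) N       ≡⟨ cong (λ e → divBy e N) (*-assoc x r N) ⟨
  divBy (x * r * N) N         ≡⟨ m*n/n≡m (x * r) N ⟩
  x * r                       ∎
  where open ≡-Reasoning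

period-< : ∀ b N L x → 1 ≤ b → 1 ≤ N → x ≤ N → period b N L x < b ^ L
period-< b N@(suc _) L x 1≤b _ x≤N = begin-strict
  x * (b ^ L ∸ 1) / N   ≤⟨ /-monoˡ-≤ N (*-monoˡ-≤ (b ^ L ∸ 1) x≤N) ⟩
  N * (b ^ L ∸ 1) / N   ≡⟨ cong (_/ N) (*-comm N (b ^ L ∸ 1)) ⟩
  (b ^ L ∸ 1) * N / N   ≡⟨ m*n/n≡m (b ^ L ∸ 1) N ⟩
  b ^ L ∸ 1             <⟨ ∸1< (m^n>0 b {{>-nonZero 1≤b}} L) ⟩
  b ^ L                 ∎
  where
  open ≤-Reasoning
  ∸1< : ∀ {n} → 1 ≤ n → n ∸ 1 < n
  ∸1< {suc n} _ = n<1+n n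

Sd≡period : ∀ b N L k d x → 1 ≤ b → 1 ≤ N → 1 ≤ d → L ≡ k * d → x ≤ N →
  Sd b N L d x ≡ period b N L x [mod b ^ k ∸ 1 ]
Sd≡period b N L k d x 1≤b 1≤N 1≤d L≡kd x≤N =
  mod-trans (≡⇒≡-mod Sd≡blockSum) (blockSum≡ b k d P 1≤b P<bᵈᵏ)
  where
  P = period b N L x
  Sd≡blockSum : Sd b N L d x ≡ blockSum b k d P
  Sd≡blockSum = trans (cong sum (map-upTo (λ i → block b (divBy L d) d P (suc i)) d))
                      (cong (λ e → blockSum b e d P) (trans (cong (λ e → divBy e d) L≡kd) (divBy-* k d 1≤d)))
  P<bᵈᵏ : P < b ^ (d * k)
  P<bᵈᵏ = subst (λ e → P < b ^ e) (trans L≡kd (*-comm k d)) (period-< b N L x 1≤b 1≤N x≤N)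

midy-modulus : ∀ b L k d → 1 ≤ d → L ≡ k * d → b ^ divBy L d ∸ 1 ≡ b ^ k ∸ 1
midy-modulus b L k d 1≤d L≡kd = cong (λ e → b ^ e ∸ 1) (trans (cong (λ e → divBy e d) L≡kd) (divBy-* k d 1≤d))

-- Midy criterion, sufficiency: if N ∣ geom d (b^k) = q N, then each period
-- x (b^L - 1)/N = x (b^k - 1) q is a multiple of b^k - 1, hence so is Sd(x).
midy-sufficient : ∀ b N L k d → 1 ≤ b → 1 ≤ N → 1 ≤ d → L ≡ k * d →
  N ∣ geom d (b ^ k) → MidyProperty b N L d
midy-sufficient b N L k d 1≤b 1≤N 1≤d L≡kd (divides q geom≡qN) x _ x<N _ =
  subst (_∣ Sd b N L d x) (sym (midy-modulus b L k d 1≤d L≡kd))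
    (mod-∣ (Sd≡period b N L k d x 1≤b 1≤N 1≤d L≡kd (<⇒≤ x<N)) M∣period)
  where
  M = b ^ k ∸ 1
  bᴸ-1≡MqN : b ^ L ∸ 1 ≡ (M * q) * N
  bᴸ-1≡MqN = begin
    b ^ L ∸ 1                 ≡⟨ cong (λ e → b ^ e ∸ 1) L≡kd ⟩
    b ^ (k * d) ∸ 1           ≡⟨ pow∸1-factor b k d ⟩
    M * geom d (b ^ k)        ≡⟨ cong (M *_) geom≡qN ⟩
    M * (q * N)               ≡⟨ *-assoc M q N ⟨
    M * q * N                 ∎
    where open ≡-Reasoning
  M∣period : M ∣ period b N L x
  M∣period = subst (M ∣_) (sym (period-exact b N L x (M * q) 1≤N bᴸ-1≡MqN))
               (∣-trans (m∣m*n q) (n∣m*n x))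

-- Midy criterion, necessity: for x = 1 the Midy property says b^k - 1
-- divides r = (b^L - 1)/N; since r N = b^L - 1 = (b^k - 1) geom d (b^k)
-- and b^k - 1 ≠ 0, this gives N ∣ geom d (b^k).  (N = 1 is trivial.)
midy-necessary : ∀ b N L k d → 2 ≤ b → 1 ≤ N → 1 ≤ d → 1 ≤ L → L ≡ k * d →
  N ∣ b ^ L ∸ 1 → MidyProperty b N L d → N ∣ geom d (b ^ k)
midy-necessary b (suc zero) L k d _ _ _ _ _ _ _ = 1∣ _
midy-necessary b N@(suc (suc _)) L k d 2≤b 1≤N 1≤d 1≤L L≡kd (divides r bᴸ-1≡rN) midy =
  divides s (*-cancelˡ-≡ (geom d (b ^ k)) (s * N) M M*geom≡M*sN)
  where
  1≤b : 1 ≤ b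
  1≤b = <⇒≤ 2≤b
  M = b ^ k ∸ 1
  instance
    M≢0 : NonZero M
    M≢0 = >-nonZero (m<n⇒0<n∸m (^-monoʳ-< b 2≤b {0} {k} (factor-pos k d 1≤L L≡kd)))
  M∣Sd₁ : M ∣ Sd b N L d 1
  M∣Sd₁ = subst (_∣ Sd b N L d 1) (midy-modulus b L k d 1≤d L≡kd)
            (midy 1 (s≤s z≤n) (s≤s (s≤s z≤n)) (1-coprimeTo N))
  M∣r : M ∣ r
  M∣r = subst (M ∣_) (trans (period-exact b N L 1 r 1≤N bᴸ-1≡rN) (*-identityˡ r))
          (mod-∣ (mod-sym (Sd≡period b N L k d 1 1≤b 1≤N 1≤d L≡kd 1≤N)) M∣Sd₁)
  s = quotient M∣r
  M*geom≡M*sN : M * geom d (b ^ k) ≡ M * (s * N)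
  M*geom≡M*sN = begin
    M * geom d (b ^ k)   ≡⟨ trans (sym (pow∸1-factor b k d)) (cong (λ e → b ^ e ∸ 1) (sym L≡kd)) ⟩
    b ^ L ∸ 1            ≡⟨ bᴸ-1≡rN ⟩
    r * N                ≡⟨ cong (_* N) (m∣n⇒n≡quotient*m M∣r) ⟩
    s * M * N            ≡⟨ rearrange s M N ⟩
    M * (s * N)          ∎
    where
    open ≡-Reasoning
    rearrange : ∀ s M N → s * M * N ≡ M * (s * N)
    rearrange = solve-∀

-- The order L of b modulo N divides every e with N ∣ b^e - 1: otherwise the
-- remainder r = e mod L would satisfy 1 ≤ r < L and b^r ≡ b^e ≡ 1.
order-divides : ∀ b N L e → 1 ≤ b → IsOrder b N L → N ∣ b ^ e ∸ 1 → L ∣ e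
order-divides b N L@(suc _) e 1≤b (_ , N∣bᴸ-1 , minimal) N∣bᵉ-1 with e % L in r≡e%L
... | zero      = m%n≡0⇒n∣m e L r≡e%L
... | r@(suc _) = contradiction (≡1⇒∣∸1 bʳ≡1) (minimal r (s≤s z≤n) r<L)
  where
  open ≡-mod-Reasoning N
  r<L : r < L
  r<L = subst (_< L) r≡e%L (m%n<n e L)
  q = e / L
  bᵉ≡bʳ*[bᴸ]^q : b ^ e ≡ b ^ r * (b ^ L) ^ q
  bᵉ≡bʳ*[bᴸ]^q = trans (cong (b ^_) (trans (m≡m%n+[m/n]*n e L) (cong (_+ q * L) r≡e%L)))
                       (trans (^-distribˡ-+-* b r (q * L)) (cong (b ^ r *_) (pow-of-multiple b q L)))
  bʳ≡1 : b ^ r ≡ 1 [mod N ]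
  bʳ≡1 = begin
    b ^ r                ≡⟨ *-identityʳ (b ^ r) ⟨
    b ^ r * 1            ≡⟨ cong (b ^ r *_) (^-zeroˡ q) ⟨
    b ^ r * 1 ^ q        ≈⟨ mod-*ˡ (b ^ r) (mod-^ q (mod-sym (∣∸1⇒≡1 (m^n>0 b {{>-nonZero 1≤b}} L) N∣bᴸ-1))) ⟩
    b ^ r * (b ^ L) ^ q  ≡⟨ bᵉ≡bʳ*[bᴸ]^q ⟨
    b ^ e                ≈⟨ ∣∸1⇒≡1 (m^n>0 b {{>-nonZero 1≤b}} e) N∣bᵉ-1 ⟩
    1                    ∎

-- Proposition 2.3.  Since N₁ ∣ N₂, L₁ ∣ L₂; write L₁ = k d and L₂ = t k d.
-- The Midy criterion turns d ∈ M_b(N₂) into N₂ ∣ geom d ((b^k)^t); hence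
-- N₁ ∣ geom d ((b^k)^t) and N₁ ∣ (b^k)^d - 1, so N₁ ∣ geom d (b^k) by
-- geom-pow-reduce, which is d ∈ M_b(N₁) by the criterion again.
proposition2p3 : (b N₁ N₂ L₁ L₂ d : ℕ) → 2 ≤ b → 1 ≤ N₁ → 1 ≤ N₂ →
    Coprime N₁ b → Coprime N₂ b → N₁ ∣ N₂ →
    IsOrder b N₁ L₁ → IsOrder b N₂ L₂ → d ∣ L₁ → d ∣ L₂ →
    InMidySet b N₂ L₂ d → InMidySet b N₁ L₁ d
proposition2p3 b N₁ N₂ L₁ L₂ d 2≤b 1≤N₁ 1≤N₂ _ _ N₁∣N₂
               ord₁@(_ , N₁∣bᴸ¹-1 , _) (1≤L₂ , N₂∣bᴸ²-1 , _) d∣L₁ _ (2≤d , _ , midy₂) =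
  2≤d , d∣L₁ , midy-sufficient b N₁ L₁ k d 1≤b 1≤N₁ 1≤d L₁≡kd N₁∣geom
  where
  1≤b = <⇒≤ 2≤b
  1≤d = <⇒≤ 2≤d
  L₁∣L₂ : L₁ ∣ L₂
  L₁∣L₂ = order-divides b N₁ L₁ L₂ 1≤b ord₁ (∣-trans N₁∣N₂ N₂∣bᴸ²-1)
  k = quotient d∣L₁
  t = quotient L₁∣L₂
  L₁≡kd : L₁ ≡ k * d
  L₁≡kd = m∣n⇒n≡quotient*m d∣L₁
  L₂≡tkd : L₂ ≡ t * k * d
  L₂≡tkd = trans (m∣n⇒n≡quotient*m L₁∣L₂) (trans (cong (t *_) L₁≡kd) (sym (*-assoc t k d)))
  N₂∣geom : N₂ ∣ geom d (b ^ (t * k))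
  N₂∣geom = midy-necessary b N₂ L₂ (t * k) d 2≤b 1≤N₂ 1≤d 1≤L₂ L₂≡tkd N₂∣bᴸ²-1 midy₂
  N₁∣geom : N₁ ∣ geom d (b ^ k)
  N₁∣geom = geom-pow-reduce N₁ (b ^ k) d t (m^n>0 b {{>-nonZero 1≤b}} k) 1≤d
    (subst (λ e → N₁ ∣ e ∸ 1) (trans (cong (b ^_) L₁≡kd) (sym (^-*-assoc b k d))) N₁∣bᴸ¹-1)
    (subst (λ e → N₁ ∣ geom d e) (pow-of-multiple b t k) (∣-trans N₁∣N₂ N₂∣geom))
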